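{- Let $n\ge 8$, $D=(\mathcal V,\mathcal A)\in EX(n)$ with maximum out-degree $\Delta^+$, and $v\in\mathcal V$ with $d^+(v)=\Delta^+$. Put $\mathcal V_1=N^+(v)$ and $\mathcal V_2=\mathcal V\setminus\mathcal V_1$. If every vertex of $\mathcal V$ has exactly one in-neighbour in $\mathcal V_1$, and $d^+(u)=\Delta^+$ for all $u\in\mathcal V_2$, then $N^+(u)=\mathcal V_1$ for all $u\in\mathcal V_2$.
   Context: Digraphs are strict (no loops, no parallel arcs). $N^+(u)$ is the out-neighbourhood of $u$ and $d^+(u)=|N^+(u)|$. A digraph is $\mathscr{F}$-free if it does not contain two distinct walks of length 2 (sequences $u\to a\to w$ of arcs, $u=w$ allowed) with the same initial and terminal vertices. $ex(n)$ is the maximum number of arcs of an $\mathscr{F}$-free digraph on $n$ vertices, and $EX(n)$ is the set of $\mathscr{F}$-free digraphs on $n$ vertices with exactly $ex(n)$ arcs. -}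

module Defs where

open import Data.Nat using (ℕ; _≤_; _+_)
open import Data.Bool using (Bool; true; false)
open import Data.Fin using (Fin)
open import Data.Product using (_×_)
open import Relation.Binary.PropositionalEquality using (_≡_)
import Data.Vec.Functional as VF

-- A digraph on vertex set Fin n, given by its (Boolean) adjacency:
-- arc u → w iff adj u w ≡ true.  Strict: no loops (parallel arcs are
-- impossible in this representation).
record Digraph (n : ℕ) : Set where
  field
    adj     : Fin n → Fin n → Bool
    loopless : ∀ u → adj u u ≡ false
open Digraph public

_⟶[_]_ : ∀ {n} → Fin n → Digraph n → Fin n → Set
u ⟶[ D ] w = adj D u w ≡ true

countTrue : ∀ {n} → (Fin n → Bool) → ℕ
countTrue f = VF.foldr (λ b k → if′ b k) 0 f
  where
  open import Data.Nat using (suc)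
  if′ : Bool → ℕ → ℕ
  if′ true k = suc k
  if′ false k = k

outdeg : ∀ {n} → Digraph n → Fin n → ℕ
outdeg D u = countTrue (adj D u)

arcs : ∀ {n} → Digraph n → ℕ
arcs D = VF.foldr _+_ 0 (λ u → outdeg D u)

-- F-free: no two distinct walks u → a → w, u → b → w (u = w allowed)
FFree : ∀ {n} → Digraph n → Set
FFree {n} D = ∀ (u a b w : Fin n) →
  u ⟶[ D ] a → a ⟶[ D ] w → u ⟶[ D ] b → b ⟶[ D ] w → a ≡ b

InEX : ∀ {n} → Digraph n → Set
InEX {n} D = FFree D × (∀ (D' : Digraph n) → FFree D' → arcs D' ≤ arcs D)

-- Let Δ = d⁺(v). As v has exactly one 2-walk to every vertex, n = Σ_{s ∈ N⁺(v)} d⁺(s).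
-- For y with d⁺(y) = Δ the sets N⁺(y) ∖ N⁺(v) and N⁺(v) ∖ N⁺(y) have equal size, the
-- first consisting of vertices of out-degree Δ and the second of vertices of out-degree
-- at most Δ; hence n ≤ Σ_{s ∈ N⁺(y)} d⁺(s), the number of 2-walks from y, which F-freeness
-- bounds by n.  So y also has a unique 2-walk to every vertex, and N⁺(v) ∖ N⁺(y) consists
-- of vertices of out-degree Δ.
--
-- No out-neighbour r of v has out-degree Δ.  If all out-degrees were Δ, the adjacency
-- matrix would satisfy A² = J: then n = Δ² is even (the trace of A² counts 2-cycles
-- twice), so Δ ≥ 4, and the complete bipartite digraph from 2Δ vertices to the other
-- Δ² − 2Δ, plus one arc, is an F-free digraph with more than Δ³ = |𝒜| arcs.  So some b
-- has out-degree ≠ Δ; every vertex of out-degree Δ points to b, and b has only one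
-- in-neighbour in N⁺(v), so N⁺(v) ∖ N⁺(r) = {r}.  Then N⁺(r) ∖ N⁺(v) has one element y,
-- and the 2-walk r → s → y has s ∈ N⁺(r) ∖ N⁺(v) with s ≠ y, a contradiction.
--
-- Finally, for u ∉ N⁺(v), any vertex of N⁺(v) ∖ N⁺(u) would be an out-neighbour of v of
-- out-degree Δ, so N⁺(v) ⊆ N⁺(u), with equality as both have size Δ.

module Submission where

open import Defs
open import Data.Bool using (Bool; true; false; not; _∧_; _∨_; if_then_else_)
import Data.Bool as Bool
open import Data.Bool.Properties
  using (∧-comm; ∧-conicalˡ; ∧-conicalʳ; ∨-identityʳ; ∨-zeroʳ; not-¬; ¬-not; T-≡)
open import Data.Empty using (⊥)
open import Data.Fin using (Fin; zero; suc; toℕ; fromℕ<)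
open import Data.Fin.Properties using (¬∀⟶∃¬; toℕ-injective; toℕ-fromℕ<)
import Data.Fin.Properties as Fin
open import Data.Nat
open import Data.Nat.Divisibility using (_∣_; _∣?_; divides; ∣m∣n⇒∣m+n; m∣m*n)
open import Data.Nat.Properties
open import Data.Nat.Tactic.RingSolver using (solve-∀)
open import Data.Product using (_×_; _,_; proj₁; proj₂; ∃-syntax; Σ-syntax)
open import Data.Sum using (_⊎_; inj₁; inj₂)
open import Function using (_∘_; case_of_)
open import Function.Bundles using (Equivalence)
open import Relation.Binary.PropositionalEquality
open import Relation.Nullary using (¬_; contradiction)
open import Relation.Nullary.Decidable using (from-no; decidable-stable)

open import Algebra.Properties.Semiring.Sum +-*-semiring
  using (sum; sum-syntax; sum-cong-≗; sum-replicate-zero; ∑-comm; ∑-distrib-+; *-distribˡ-sum)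

sum-const : ∀ n c → ∑[ i < n ] c ≡ n * c
sum-const zero    c = refl
sum-const (suc n) c = cong (c +_) (sum-const n c)

sum-mono-≤ : ∀ {n} {f g : Fin n → ℕ} → (∀ i → f i ≤ g i) → sum f ≤ sum g
sum-mono-≤ {zero}  _   = z≤n
sum-mono-≤ {suc n} f≤g = +-mono-≤ (f≤g zero) (sum-mono-≤ (f≤g ∘ suc))

sum-mono-< : ∀ {n} {f g : Fin n → ℕ} → (∀ i → f i ≤ g i) → ∀ i → f i < g i → sum f < sum g
sum-mono-< f≤g zero    fi<gi = +-mono-<-≤ fi<gi (sum-mono-≤ (f≤g ∘ suc))
sum-mono-< f≤g (suc i) fi<gi = +-mono-≤-< (f≤g zero) (sum-mono-< (f≤g ∘ suc) i fi<gi)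

sum-mono-≤-equality : ∀ {n} {f g : Fin n → ℕ} → (∀ i → f i ≤ g i) → sum g ≤ sum f →
                      ∀ i → f i ≡ g i
sum-mono-≤-equality f≤g Σg≤Σf i =
  ≤-antisym (f≤g i) (≮⇒≥ λ fi<gi → <⇒≱ (sum-mono-< f≤g i fi<gi) Σg≤Σf)

term≤sum : ∀ {n} (f : Fin n → ℕ) i → f i ≤ sum f
term≤sum f zero    = m≤m+n (f zero) _
term≤sum f (suc i) = ≤-trans (term≤sum (f ∘ suc) i) (m≤n+m _ (f zero))

two-terms≤sum : ∀ {n} (f : Fin n → ℕ) {i j} → i ≢ j → f i + f j ≤ sum f
two-terms≤sum f {zero}  {zero}  i≢j = contradiction refl i≢j
two-terms≤sum f {zero}  {suc j} _   = +-monoʳ-≤ (f zero) (term≤sum (f ∘ suc) j)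
two-terms≤sum f {suc i} {zero}  _   =
  subst (_≤ sum f) (+-comm (f zero) _) (+-monoʳ-≤ (f zero) (term≤sum (f ∘ suc) i))
two-terms≤sum f {suc i} {suc j} i≢j =
  ≤-trans (two-terms≤sum (f ∘ suc) (i≢j ∘ cong suc)) (m≤n+m _ (f zero))

sum-positive : ∀ {n} (f : Fin n → ℕ) → 0 < sum f → ∃[ i ] 0 < f i
sum-positive {suc n} f Σf>0 with f zero in f₀
... | suc _ = zero , subst (0 <_) (sym f₀) z<s
... | zero  = let i , fi>0 = sum-positive (f ∘ suc) Σf>0 in suc i , fi>0

sum≤1 : ∀ {n} (f : Fin n → ℕ) → (∀ i → f i ≤ 1) → (∀ i j → 0 < f i → 0 < f j → i ≡ j) →
        sum f ≤ 1
sum≤1 {zero}  f _   _      = z≤n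
sum≤1 {suc n} f f≤1 unique with f zero in f₀
... | zero  = sum≤1 (f ∘ suc) (f≤1 ∘ suc) λ i j fi>0 fj>0 → Fin.suc-injective (unique _ _ fi>0 fj>0)
... | suc k =
  ≤-trans (≤-reflexive (trans (cong (suc k +_) tail≡0) (+-identityʳ _))) (subst (_≤ 1) f₀ (f≤1 zero))
  where
  tail-zero : ∀ i → f (suc i) ≡ 0
  tail-zero i with f (suc i) in fᵢ
  ... | zero  = refl
  ... | suc _ with unique zero (suc i) (subst (0 <_) (sym f₀) z<s) (subst (0 <_) (sym fᵢ) z<s)
  ... | ()
  tail≡0 : sum (f ∘ suc) ≡ 0
  tail≡0 = trans (sum-cong-≗ tail-zero) (sum-replicate-zero n)

_∩_ _∖_ : ∀ {n} → (Fin n → Bool) → (Fin n → Bool) → Fin n → Bool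
(p ∩ q) s = p s ∧ q s
(p ∖ q) s = p s ∧ not (q s)

∈∖ : ∀ {n} (p q : Fin n → Bool) {s} → p s ≡ true → q s ≢ true → (p ∖ q) s ≡ true
∈∖ p q ps s∉q = cong₂ (λ a b → a ∧ not b) ps (¬-not s∉q)

∈∖⁻ : ∀ {n} (p q : Fin n → Bool) {s} → (p ∖ q) s ≡ true → p s ≡ true × q s ≢ true
∈∖⁻ p q {s} s∈ with p s | q s
... | true | false = refl , λ ()

restrict : ∀ {n} → (Fin n → Bool) → (Fin n → ℕ) → Fin n → ℕ
restrict p g s = if p s then g s else 0

sumOn : ∀ {n} → (Fin n → Bool) → (Fin n → ℕ) → ℕ
sumOn p g = sum (restrict p g)

countTrue-sumOn : ∀ {n} (p : Fin n → Bool) → countTrue p ≡ sumOn p (λ _ → 1)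
countTrue-sumOn {zero}  p = refl
countTrue-sumOn {suc n} p with p zero
... | true  = cong suc (countTrue-sumOn (p ∘ suc))
... | false = countTrue-sumOn (p ∘ suc)

module _ {n : ℕ} where

  sumOn-const : ∀ (p : Fin n → Bool) c → sumOn p (λ _ → c) ≡ c * countTrue p
  sumOn-const p c = begin
    sumOn p (λ _ → c)                 ≡⟨ sum-cong-≗ (λ s → scale (p s)) ⟩
    ∑[ s < n ] (c * (if p s then 1 else 0)) ≡⟨ *-distribˡ-sum c (restrict p (λ _ → 1)) ⟨
    c * sumOn p (λ _ → 1)             ≡⟨ cong (c *_) (countTrue-sumOn p) ⟨
    c * countTrue p                   ∎
    where
    open ≡-Reasoning
    scale : ∀ b → (if b then c else 0) ≡ c * (if b then 1 else 0)
    scale true  = sym (*-identityʳ c)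
    scale false = sym (*-zeroʳ c)

  sumOn-split : ∀ (p q : Fin n → Bool) g → sumOn p g ≡ sumOn (p ∩ q) g + sumOn (p ∖ q) g
  sumOn-split p q g =
    trans (sum-cong-≗ λ s → split (p s) (q s) (g s)) (∑-distrib-+ (restrict (p ∩ q) g) (restrict (p ∖ q) g))
    where
    split : ∀ a b x → (if a then x else 0) ≡ (if a ∧ b then x else 0) + (if a ∧ not b then x else 0)
    split true  true  x = sym (+-identityʳ x)
    split true  false x = refl
    split false b     x = refl

  sumOn-∩-comm : ∀ (p q : Fin n → Bool) g → sumOn (p ∩ q) g ≡ sumOn (q ∩ p) g
  sumOn-∩-comm p q g = sum-cong-≗ λ s → cong (λ b → if b then g s else 0) (∧-comm (p s) (q s))

  module _ {p : Fin n → Bool} {g h : Fin n → ℕ} where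

    private
      restrict-mono : (∀ s → p s ≡ true → g s ≤ h s) → ∀ s → restrict p g s ≤ restrict p h s
      restrict-mono g≤h s with p s in ps
      ... | true  = g≤h s ps
      ... | false = z≤n

    sumOn-mono : (∀ s → p s ≡ true → g s ≤ h s) → sumOn p g ≤ sumOn p h
    sumOn-mono g≤h = sum-mono-≤ (restrict-mono g≤h)

    sumOn-mono-equality : (∀ s → p s ≡ true → g s ≤ h s) → sumOn p h ≤ sumOn p g →
                          ∀ s → p s ≡ true → g s ≡ h s
    sumOn-mono-equality g≤h Σh≤Σg s ps =
      subst (λ b → (if b then g s else 0) ≡ (if b then h s else 0)) ps
        (sum-mono-≤-equality (restrict-mono g≤h) Σh≤Σg s)

  sumOn-cong : ∀ {p : Fin n → Bool} {g h : Fin n → ℕ} → (∀ s → p s ≡ true → g s ≡ h s) →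
               sumOn p g ≡ sumOn p h
  sumOn-cong g≡h = ≤-antisym (sumOn-mono λ s ps → ≤-reflexive (g≡h s ps))
                             (sumOn-mono λ s ps → ≤-reflexive (sym (g≡h s ps)))

  countTrue-split : ∀ (p q : Fin n → Bool) → countTrue p ≡ countTrue (p ∩ q) + countTrue (p ∖ q)
  countTrue-split p q = begin
    countTrue p
      ≡⟨ countTrue-sumOn p ⟩
    sumOn p (λ _ → 1)
      ≡⟨ sumOn-split p q _ ⟩
    sumOn (p ∩ q) (λ _ → 1) + sumOn (p ∖ q) (λ _ → 1)
      ≡⟨ cong₂ _+_ (countTrue-sumOn (p ∩ q)) (countTrue-sumOn (p ∖ q)) ⟨
    countTrue (p ∩ q) + countTrue (p ∖ q) ∎
    where open ≡-Reasoning

  countTrue-∖-sym : ∀ {p q : Fin n → Bool} → countTrue p ≡ countTrue q →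
                    countTrue (p ∖ q) ≡ countTrue (q ∖ p)
  countTrue-∖-sym {p} {q} |p|≡|q| = +-cancelˡ-≡ (countTrue (p ∩ q)) _ _ (begin
    countTrue (p ∩ q) + countTrue (p ∖ q) ≡⟨ countTrue-split p q ⟨
    countTrue p                           ≡⟨ |p|≡|q| ⟩
    countTrue q                           ≡⟨ countTrue-split q p ⟩
    countTrue (q ∩ p) + countTrue (q ∖ p) ≡⟨ cong (_+ countTrue (q ∖ p)) |q∩p|≡|p∩q| ⟩
    countTrue (p ∩ q) + countTrue (q ∖ p) ∎)
    where
    open ≡-Reasoning
    |q∩p|≡|p∩q| : countTrue (q ∩ p) ≡ countTrue (p ∩ q)
    |q∩p|≡|p∩q| =
      trans (countTrue-sumOn (q ∩ p)) (trans (sumOn-∩-comm q p _) (sym (countTrue-sumOn (p ∩ q))))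

private
  indicator-positive : ∀ b → 0 < (if b then 1 else 0) → b ≡ true
  indicator-positive true _ = refl

module _ {n : ℕ} {p : Fin n → Bool} where

  countTrue-positive : ∀ {i} → p i ≡ true → 0 < countTrue p
  countTrue-positive {i} pi = subst (0 <_) (sym (countTrue-sumOn p))
    (≤-trans (≤-reflexive (cong (λ b → if b then 1 else 0) (sym pi))) (term≤sum _ i))

  countTrue-positive⇒∃ : 0 < countTrue p → ∃[ i ] p i ≡ true
  countTrue-positive⇒∃ |p|>0 =
    let i , pᵢ>0 = sum-positive _ (subst (0 <_) (countTrue-sumOn p) |p|>0)
    in i , indicator-positive (p i) pᵢ>0

  countTrue≥2 : ∀ {i j} → i ≢ j → p i ≡ true → p j ≡ true → 2 ≤ countTrue p
  countTrue≥2 {i} {j} i≢j pi pj = subst (2 ≤_) (sym (countTrue-sumOn p))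
    (subst₂ (λ b c → (if b then 1 else 0) + (if c then 1 else 0) ≤ sumOn p (λ _ → 1)) pi pj
      (two-terms≤sum _ i≢j))

  countTrue≤1 : (∀ i j → p i ≡ true → p j ≡ true → i ≡ j) → countTrue p ≤ 1
  countTrue≤1 unique = subst (_≤ 1) (sym (countTrue-sumOn p))
    (sum≤1 _ (λ i → indicator≤1 (p i))
      λ i j pᵢ>0 pⱼ>0 → unique i j (indicator-positive (p i) pᵢ>0) (indicator-positive (p j) pⱼ>0))
    where
    indicator≤1 : ∀ b → (if b then 1 else 0) ≤ 1
    indicator≤1 true  = ≤-refl
    indicator≤1 false = z≤n


countTrue-cong : ∀ {n} {p q : Fin n → Bool} → (∀ s → p s ≡ q s) → countTrue p ≡ countTrue q
countTrue-cong {p = p} {q} p≗q = trans (countTrue-sumOn p)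
  (trans (sum-cong-≗ λ s → cong (λ b → if b then 1 else 0) (p≗q s)) (sym (countTrue-sumOn q)))

∖-nonempty-sym : ∀ {n} {p q : Fin n → Bool} {i} → countTrue p ≡ countTrue q → (p ∖ q) i ≡ true →
                 ∃[ j ] (q ∖ p) j ≡ true
∖-nonempty-sym {p = p} {q} |p|≡|q| i∈p∖q = countTrue-positive⇒∃
  (subst (0 <_) (countTrue-∖-sym {p = p} {q = q} |p|≡|q|) (countTrue-positive {p = p ∖ q} i∈p∖q))

module _ {n : ℕ} {p q : Fin n → Bool} {g : Fin n → ℕ} {k : ℕ}
         (|p|≡|q| : countTrue p ≡ countTrue q)
         (g≡k : ∀ s → (p ∖ q) s ≡ true → g s ≡ k)
         (g≤k : ∀ s → (q ∖ p) s ≡ true → g s ≤ k) where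

  private
    sumOn-p : sumOn p g ≡ sumOn (q ∩ p) g + sumOn (q ∖ p) (λ _ → k)
    sumOn-p = begin
      sumOn p g                                  ≡⟨ sumOn-split p q g ⟩
      sumOn (p ∩ q) g + sumOn (p ∖ q) g          ≡⟨ cong₂ _+_ (sumOn-∩-comm p q g) (sumOn-cong g≡k) ⟩
      sumOn (q ∩ p) g + sumOn (p ∖ q) (λ _ → k)  ≡⟨ cong (sumOn (q ∩ p) g +_) |p∖q|k≡|q∖p|k ⟩
      sumOn (q ∩ p) g + sumOn (q ∖ p) (λ _ → k)  ∎
      where
      open ≡-Reasoning
      |p∖q|k≡|q∖p|k : sumOn (p ∖ q) (λ _ → k) ≡ sumOn (q ∖ p) (λ _ → k)
      |p∖q|k≡|q∖p|k = trans (sumOn-const (p ∖ q) k)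
        (trans (cong (k *_) (countTrue-∖-sym {p = p} {q = q} |p|≡|q|)) (sym (sumOn-const (q ∖ p) k)))

  sumOn-exchange : sumOn q g ≤ sumOn p g
  sumOn-exchange = begin
    sumOn q g                                  ≡⟨ sumOn-split q p g ⟩
    sumOn (q ∩ p) g + sumOn (q ∖ p) g          ≤⟨ +-monoʳ-≤ _ (sumOn-mono g≤k) ⟩
    sumOn (q ∩ p) g + sumOn (q ∖ p) (λ _ → k)  ≡⟨ sumOn-p ⟨
    sumOn p g                                  ∎
    where open ≤-Reasoning

  sumOn-exchange-equality : sumOn p g ≤ sumOn q g → ∀ s → (q ∖ p) s ≡ true → g s ≡ k
  sumOn-exchange-equality Σp≤Σq = sumOn-mono-equality g≤k (+-cancelˡ-≤ (sumOn (q ∩ p) g) _ _ (begin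
    sumOn (q ∩ p) g + sumOn (q ∖ p) (λ _ → k)  ≡⟨ sumOn-p ⟨
    sumOn p g                                  ≤⟨ Σp≤Σq ⟩
    sumOn q g                                  ≡⟨ sumOn-split q p g ⟩
    sumOn (q ∩ p) g + sumOn (q ∖ p) g          ∎))
    where open ≤-Reasoning

∑∑-symmetric-even : ∀ {n} (g : Fin n → Fin n → ℕ) → (∀ i j → g i j ≡ g j i) → (∀ i → g i i ≡ 0) →
                    2 ∣ ∑[ i < n ] ∑[ j < n ] g i j
∑∑-symmetric-even {zero}  g _     _    = divides 0 refl
∑∑-symmetric-even {suc n} g g-sym g-diag =
  subst (2 ∣_) (sym total) (∣m∣n⇒∣m+n (m∣m*n c) (∑∑-symmetric-even (λ i j → g (suc i) (suc j))
    (λ i j → g-sym (suc i) (suc j)) (g-diag ∘ suc)))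
  where
  open ≡-Reasoning
  c rest : ℕ
  c    = ∑[ j < n ] g zero (suc j)
  rest = ∑[ i < n ] ∑[ j < n ] g (suc i) (suc j)
  total : ∑[ i < suc n ] ∑[ j < suc n ] g i j ≡ 2 * c + rest
  total = begin
    (g zero zero + c) + ∑[ i < n ] (g (suc i) zero + ∑[ j < n ] g (suc i) (suc j))
      ≡⟨ cong₂ _+_ (cong (_+ c) (g-diag zero)) (∑-distrib-+ (λ i → g (suc i) zero) _) ⟩
    c + (∑[ i < n ] g (suc i) zero + rest)
      ≡⟨ cong (λ t → c + (t + rest)) (sum-cong-≗ λ i → g-sym (suc i) zero) ⟩
    c + (c + rest)
      ≡⟨ +-assoc c c rest ⟨
    c + c + rest
      ≡⟨ cong (λ t → c + t + rest) (+-identityʳ c) ⟨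
    2 * c + rest ∎

⟶-irrefl : ∀ {n} (D : Digraph n) x → ¬ x ⟶[ D ] x
⟶-irrefl D x = not-¬ (loopless D x)

walks₂ : ∀ {n} → Digraph n → Fin n → Fin n → ℕ
walks₂ D x z = countTrue (λ s → adj D x s ∧ adj D s z)

module _ {n : ℕ} (D : Digraph n) where

  walks₂≤1 : FFree D → ∀ x z → walks₂ D x z ≤ 1
  walks₂≤1 ff x z = countTrue≤1 λ a b x→a→z x→b→z →
    ff x a b z (∧-conicalˡ _ _ x→a→z) (∧-conicalʳ _ _ x→a→z)
               (∧-conicalˡ _ _ x→b→z) (∧-conicalʳ _ _ x→b→z)

  walks₂≡1 : FFree D → ∀ {x a z} → x ⟶[ D ] a → a ⟶[ D ] z → walks₂ D x z ≡ 1
  walks₂≡1 ff {x} {a} {z} x→a a→z =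
    ≤-antisym (walks₂≤1 ff x z)
              (countTrue-positive {p = λ s → adj D x s ∧ adj D s z} (cong₂ _∧_ x→a a→z))

  ∑-walks₂ : ∀ x → ∑[ z < n ] walks₂ D x z ≡ sumOn (adj D x) (outdeg D)
  ∑-walks₂ x = begin
    ∑[ z < n ] walks₂ D x z
      ≡⟨ sum-cong-≗ (λ z → countTrue-sumOn (λ s → adj D x s ∧ adj D s z)) ⟩
    ∑[ z < n ] ∑[ s < n ] (if adj D x s ∧ adj D s z then 1 else 0)
      ≡⟨ ∑-comm (λ z s → if adj D x s ∧ adj D s z then 1 else 0) ⟩
    ∑[ s < n ] ∑[ z < n ] (if adj D x s ∧ adj D s z then 1 else 0)
      ≡⟨ sum-cong-≗ (λ s → count-through (adj D x s) (adj D s)) ⟩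
    sumOn (adj D x) (outdeg D) ∎
    where
    open ≡-Reasoning
    count-through : ∀ b (c : Fin n → Bool) →
      ∑[ z < n ] (if b ∧ c z then 1 else 0) ≡ (if b then countTrue c else 0)
    count-through true  c = sym (countTrue-sumOn c)
    count-through false c = sum-replicate-zero n

  walks₂-trace-even : 2 ∣ ∑[ x < n ] walks₂ D x x
  walks₂-trace-even =
    subst (2 ∣_) (sum-cong-≗ λ x → sym (countTrue-sumOn (λ s → adj D x s ∧ adj D s x)))
    (∑∑-symmetric-even (λ x s → if adj D x s ∧ adj D s x then 1 else 0)
      (λ x s → cong (λ b → if b then 1 else 0) (∧-comm (adj D x s) (adj D s x)))
      (λ x → cong (λ b → if b ∧ b then 1 else 0) (loopless D x)))

countTrue-<ᵇ : ∀ a b → countTrue {a + b} (λ i → toℕ i <ᵇ a) ≡ a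
countTrue-<ᵇ zero    b = countTrue-false b
  where
  countTrue-false : ∀ n → countTrue {n} (λ _ → false) ≡ 0
  countTrue-false zero    = refl
  countTrue-false (suc n) = countTrue-false n
countTrue-<ᵇ (suc a) b = cong suc (countTrue-<ᵇ a b)

countTrue-≮ᵇ : ∀ a b → countTrue {a + b} (λ i → not (toℕ i <ᵇ a)) ≡ b
countTrue-≮ᵇ zero    b = countTrue-true b
  where
  countTrue-true : ∀ n → countTrue {n} (λ _ → true) ≡ n
  countTrue-true zero    = refl
  countTrue-true (suc n) = cong suc (countTrue-true n)
countTrue-≮ᵇ (suc a) b = countTrue-≮ᵇ a b

private
  ≡ᵇ-true : ∀ m n → (m ≡ᵇ n) ≡ true → m ≡ n
  ≡ᵇ-true m n = ≡ᵇ⇒≡ m n ∘ Equivalence.from T-≡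

  ≡ᵇ-refl : ∀ m → (m ≡ᵇ m) ≡ true
  ≡ᵇ-refl m = Equivalence.to T-≡ (≡⇒≡ᵇ m m refl)

  <ᵇ-true : ∀ m n → (m <ᵇ n) ≡ true → m < n
  <ᵇ-true m n = <ᵇ⇒< m n ∘ Equivalence.from T-≡

module BipartitePlusArc (a b : ℕ) (1≤a : 1 ≤ a) (1≤b : 1 ≤ b) where

  private
    V : Set
    V = Fin (a + b)

    left : V → Bool
    left i = toℕ i <ᵇ a

    arc : V → V → Bool
    arc i j = (left i ∧ not (left j)) ∨ ((toℕ i ≡ᵇ a) ∧ (toℕ j ≡ᵇ 0))

    arc-cases : ∀ i j → arc i j ≡ true → (left i ≡ true × left j ≡ false) ⊎ (toℕ i ≡ a × toℕ j ≡ 0)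
    arc-cases i j ij with left i | left j | toℕ i ≡ᵇ a in i≡a | toℕ j ≡ᵇ 0 in j≡0
    ... | true | false | _    | _    = inj₁ (refl , refl)
    ... | _    | _     | true | true = inj₂ (≡ᵇ-true (toℕ i) a i≡a , ≡ᵇ-true (toℕ j) 0 j≡0)
    arc-cases i j () | true  | true | false | _
    arc-cases i j () | true  | true | true  | false
    arc-cases i j () | false | _    | false | _
    arc-cases i j () | false | _    | true  | false

    loopless-arc : ∀ i → arc i i ≡ false
    loopless-arc i = ¬-not λ ii → case arc-cases i i ii of λ where
      (inj₁ (i∈left , i∉left)) → contradiction (trans (sym i∈left) i∉left) λ ()
      (inj₂ (i≡a , i≡0))       → >⇒≢ 1≤a (trans (sym i≡a) i≡0)

    a-not-left : ∀ {i} → toℕ i ≡ a → left i ≡ false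
    a-not-left i≡a = ¬-not λ li → <-irrefl i≡a (<ᵇ-true _ a li)

    middle : ∀ {u x w} → arc u x ≡ true → arc x w ≡ true → toℕ x ≡ (if left u then a else 0)
    middle {u} {x} {w} ux xw with arc-cases u x ux | arc-cases x w xw
    ... | inj₁ (_  , x∉left) | inj₁ (x∈left , _) = contradiction (trans (sym x∈left) x∉left) λ ()
    ... | inj₁ (u∈left , _)  | inj₂ (x≡a , _)    =
      subst (λ l → toℕ x ≡ (if l then a else 0)) (sym u∈left) x≡a
    ... | inj₂ (u≡a , x≡0)   | _                 =
      subst (λ l → toℕ x ≡ (if l then a else 0)) (sym (a-not-left u≡a)) x≡0

    left⇒arc : ∀ {i} → left i ≡ true → ∀ j → arc i j ≡ not (left j)
    left⇒arc {i} li j =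
      trans (cong₂ (λ l e → (l ∧ not (left j)) ∨ (e ∧ (toℕ j ≡ᵇ 0))) li i≢a)
            (∨-identityʳ (not (left j)))
      where
      i≢a : (toℕ i ≡ᵇ a) ≡ false
      i≢a = ¬-not λ e → <-irrefl (≡ᵇ-true (toℕ i) a e) (<ᵇ-true _ a li)

  digraph : Digraph (a + b)
  digraph = record { adj = arc ; loopless = loopless-arc }

  FFree-digraph : FFree digraph
  FFree-digraph u x y w ux xw uy yw = toℕ-injective (trans (middle ux xw) (sym (middle uy yw)))

  a*b<arcs : a * b < arcs digraph
  a*b<arcs = begin-strict
    a * b                     ≡⟨ *-comm a b ⟩
    b * a                     ≡⟨ cong (b *_) (countTrue-<ᵇ a b) ⟨
    b * countTrue left        ≡⟨ sumOn-const left b ⟨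
    sumOn left (λ _ → b)      <⟨ sum-mono-< out-left apex
                                   (subst (_< outdeg digraph apex) (sym apex-lower) apex-out) ⟩
    arcs digraph              ∎
    where
    open ≤-Reasoning
    apex origin : V
    apex   = fromℕ< (m<m+n a 1≤b)
    origin = fromℕ< (≤-trans 1≤a (m≤m+n a b))
    out-left : ∀ i → (if left i then b else 0) ≤ outdeg digraph i
    out-left i = bound (left i) refl
      where
      bound : ∀ l → left i ≡ l → (if l then b else 0) ≤ outdeg digraph i
      bound true  li = ≤-reflexive (sym (trans (countTrue-cong (left⇒arc li)) (countTrue-≮ᵇ a b)))
      bound false _  = z≤n
    apex-lower : (if left apex then b else 0) ≡ 0
    apex-lower rewrite a-not-left {apex} (toℕ-fromℕ< (m<m+n a 1≤b)) = refl
    apex-out : 0 < outdeg digraph apex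
    apex-out = countTrue-positive {i = origin} apex→origin
      where
      apex→origin : arc apex origin ≡ true
      apex→origin
        rewrite toℕ-fromℕ< (m<m+n a 1≤b) | toℕ-fromℕ< (≤-trans 1≤a (m≤m+n a b)) | ≡ᵇ-refl a
        = ∨-zeroʳ _

∃-FFree-with-a*b<arcs : ∀ a b → 1 ≤ a → 1 ≤ b → Σ[ D ∈ Digraph (a + b) ] (FFree D × a * b < arcs D)
∃-FFree-with-a*b<arcs a b 1≤a 1≤b = digraph , FFree-digraph , a*b<arcs
  where open BipartitePlusArc a b 1≤a 1≤b

private
  square-split : ∀ m → (4 + m) * (4 + m) ≡ (4 + m) + (4 + m) + (4 + m) * (2 + m)
  square-split = solve-∀

  cube-split : ∀ m → (4 + m + (4 + m)) * ((4 + m) * (2 + m)) ≡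
                     (4 + m) * (4 + m) * (4 + m) + (4 + m) * (4 + m) * m
  cube-split = solve-∀

∃-FFree-with-k³<arcs : ∀ {n k} → n ≡ k * k → 4 ≤ k → Σ[ D ∈ Digraph n ] (FFree D × n * k < arcs D)
∃-FFree-with-k³<arcs {k = k} refl (s≤s (s≤s (s≤s (s≤s {n = m} _))))
  with ∃-FFree-with-a*b<arcs (k + k) (k * (2 + m)) z<s z<s
... | D , FFree-D , 2k*c<arcs =
  subst (λ N → Σ[ D ∈ Digraph N ] (FFree D × k * k * k < arcs D)) (sym (square-split m))
    (D , FFree-D , ≤-<-trans k³≤2k*c 2k*c<arcs)
  where
  k³≤2k*c : k * k * k ≤ (k + k) * (k * (2 + m))
  k³≤2k*c = ≤-trans (m≤m+n (k * k * k) (k * k * m)) (≤-reflexive (sym (cube-split m)))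

even-square≥8⇒4≤ : ∀ k → 8 ≤ k * k → 2 ∣ k * k → 4 ≤ k
even-square≥8⇒4≤ 0 () _
even-square≥8⇒4≤ 1 (s≤s ()) _
even-square≥8⇒4≤ 2 (s≤s (s≤s (s≤s (s≤s ())))) _
even-square≥8⇒4≤ 3 _ 2∣9 = contradiction 2∣9 (from-no (2 ∣? 9))
even-square≥8⇒4≤ (suc (suc (suc (suc _)))) _ _ = s≤s (s≤s (s≤s (s≤s z≤n)))

module _ {n : ℕ} {D : Digraph n} (D∈EX : InEX D) (8≤n : 8 ≤ n) where

  regular-unique-walks-impossible : ∀ {k} → (∀ x → outdeg D x ≡ k) → (∀ x z → walks₂ D x z ≡ 1) → ⊥
  regular-unique-walks-impossible {k} regular unique-walks =
    let 4≤k = even-square≥8⇒4≤ k (subst (8 ≤_) n≡k*k 8≤n) (subst (2 ∣_) n≡k*k 2∣n)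
        D′ , FFree-D′ , n*k<arcs = ∃-FFree-with-k³<arcs n≡k*k 4≤k
    in <⇒≱ n*k<arcs (≤-trans (proj₂ D∈EX D′ FFree-D′) (≤-reflexive arcs≡n*k))
    where
    open ≡-Reasoning
    x₀ : Fin n
    x₀ = fromℕ< (≤-trans (s≤s z≤n) 8≤n)
    n≡∑1 : ∀ (f : Fin n → ℕ) → (∀ x → f x ≡ 1) → n ≡ sum f
    n≡∑1 f f≡1 = trans (sym (*-identityʳ n)) (trans (sym (sum-const n 1)) (sum-cong-≗ (sym ∘ f≡1)))
    n≡k*k : n ≡ k * k
    n≡k*k = begin
      n                                ≡⟨ n≡∑1 (walks₂ D x₀) (unique-walks x₀) ⟩
      ∑[ z < n ] walks₂ D x₀ z          ≡⟨ ∑-walks₂ D x₀ ⟩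
      sumOn (adj D x₀) (outdeg D)      ≡⟨ sumOn-cong (λ s _ → regular s) ⟩
      sumOn (adj D x₀) (λ _ → k)       ≡⟨ sumOn-const (adj D x₀) k ⟩
      k * outdeg D x₀                  ≡⟨ cong (k *_) (regular x₀) ⟩
      k * k                            ∎
    2∣n : 2 ∣ n
    2∣n = subst (2 ∣_) (sym (n≡∑1 (λ x → walks₂ D x x) (λ x → unique-walks x x)))
                (walks₂-trace-even D)
    arcs≡n*k : arcs D ≡ n * k
    arcs≡n*k = trans (sum-cong-≗ regular) (sum-const n k)

module MaxOutDegree {n : ℕ} {D : Digraph n} (D-FFree : FFree D) {v : Fin n}
  (Δ-max : ∀ u → outdeg D u ≤ outdeg D v)
  (unique-walks-from-v : ∀ z → walks₂ D v z ≡ 1)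
  (Δ-off-N⁺v : ∀ u → ¬ v ⟶[ D ] u → outdeg D u ≡ outdeg D v) where

  Δ : ℕ
  Δ = outdeg D v

  n≡sumOn-N⁺v : n ≡ sumOn (adj D v) (outdeg D)
  n≡sumOn-N⁺v = begin
    n                          ≡⟨ *-identityʳ n ⟨
    n * 1                      ≡⟨ sum-const n 1 ⟨
    ∑[ z < n ] 1               ≡⟨ sum-cong-≗ (sym ∘ unique-walks-from-v) ⟩
    ∑[ z < n ] walks₂ D v z    ≡⟨ ∑-walks₂ D v ⟩
    sumOn (adj D v) (outdeg D) ∎
    where open ≡-Reasoning

  module _ {y : Fin n} (dy≡Δ : outdeg D y ≡ Δ) where

    private
      sumOn-N⁺y≤n : sumOn (adj D y) (outdeg D) ≤ n
      sumOn-N⁺y≤n = begin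
        sumOn (adj D y) (outdeg D) ≡⟨ ∑-walks₂ D y ⟨
        ∑[ z < n ] walks₂ D y z    ≤⟨ sum-mono-≤ (walks₂≤1 D D-FFree y) ⟩
        ∑[ z < n ] 1               ≡⟨ trans (sum-const n 1) (*-identityʳ n) ⟩
        n                          ∎
        where open ≤-Reasoning

      Δ-on-N⁺y∖N⁺v : ∀ s → (adj D y ∖ adj D v) s ≡ true → outdeg D s ≡ Δ
      Δ-on-N⁺y∖N⁺v s s∈ = Δ-off-N⁺v s (proj₂ (∈∖⁻ (adj D y) (adj D v) s∈))

    unique-walks-from-max : ∀ z → walks₂ D y z ≡ 1
    unique-walks-from-max = sum-mono-≤-equality (walks₂≤1 D D-FFree y) (begin
      ∑[ z < n ] 1               ≡⟨ trans (sum-const n 1) (*-identityʳ n) ⟩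
      n                          ≡⟨ n≡sumOn-N⁺v ⟩
      sumOn (adj D v) (outdeg D) ≤⟨ sumOn-exchange dy≡Δ Δ-on-N⁺y∖N⁺v (λ s _ → Δ-max s) ⟩
      sumOn (adj D y) (outdeg D) ≡⟨ ∑-walks₂ D y ⟨
      ∑[ z < n ] walks₂ D y z    ∎)
      where open ≤-Reasoning

    lost-neighbour-max : ∀ {s} → v ⟶[ D ] s → ¬ y ⟶[ D ] s → outdeg D s ≡ Δ
    lost-neighbour-max {s} v→s y↛s =
      sumOn-exchange-equality dy≡Δ Δ-on-N⁺y∖N⁺v (λ s _ → Δ-max s)
        (≤-trans sumOn-N⁺y≤n (≤-reflexive n≡sumOn-N⁺v)) s (∈∖ (adj D v) (adj D y) v→s y↛s)

  module _ {r b : Fin n} (v→r : v ⟶[ D ] r) (dr≡Δ : outdeg D r ≡ Δ) (db≢Δ : outdeg D b ≢ Δ) where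

    private
      max⇒→b : ∀ {a} → outdeg D a ≡ Δ → a ⟶[ D ] b
      max⇒→b {a} da≡Δ with adj D v b in v→b | adj D a b in a→b
      ... | false | _     = contradiction (Δ-off-N⁺v b (not-¬ v→b)) db≢Δ
      ... | true  | true  = refl
      ... | true  | false = contradiction (lost-neighbour-max da≡Δ v→b (not-¬ a→b)) db≢Δ

      R W : Fin n → Bool
      R = adj D v ∖ adj D r
      W = adj D r ∖ adj D v

      R-is-r : ∀ s → R s ≡ true → s ≡ r
      R-is-r s s∈R = let v→s , r↛s = ∈∖⁻ (adj D v) (adj D r) s∈R in
        D-FFree v s r b v→s (max⇒→b (lost-neighbour-max dr≡Δ v→s r↛s)) v→r (max⇒→b dr≡Δ)

      |W|≤1 : countTrue W ≤ 1
      |W|≤1 = subst (_≤ 1) (countTrue-∖-sym {p = adj D v} {q = adj D r} (sym dr≡Δ))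
        (countTrue≤1 λ i j i∈R j∈R → trans (R-is-r i i∈R) (sym (R-is-r j j∈R)))

      W-nonempty : ∃[ y ] W y ≡ true
      W-nonempty =
        ∖-nonempty-sym {p = adj D v} (sym dr≡Δ) (∈∖ (adj D v) (adj D r) v→r (⟶-irrefl D r))

    max-out-neighbour-impossible : ⊥
    max-out-neighbour-impossible with W-nonempty
    ... | y , y∈W with countTrue-positive⇒∃ (subst (0 <_) (sym (unique-walks-from-max dr≡Δ y)) z<s)
    ... | s , r→s→y = <⇒≱ (countTrue≥2 s≢y s∈W y∈W) |W|≤1
      where
      r→s = ∧-conicalˡ _ _ r→s→y
      s→y = ∧-conicalʳ _ _ r→s→y
      r→y = proj₁ (∈∖⁻ (adj D r) (adj D v) y∈W)
      v↛s : ¬ v ⟶[ D ] s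
      v↛s v→s = ⟶-irrefl D r (subst (r ⟶[ D ]_) (D-FFree v s r y v→s s→y v→r r→y) r→s)
      s∈W : W s ≡ true
      s∈W = ∈∖ (adj D r) (adj D v) r→s v↛s
      s≢y : s ≢ y
      s≢y s≡y = ⟶-irrefl D y (subst (_⟶[ D ] y) s≡y s→y)

  ∃-non-max-vertex : InEX D → 8 ≤ n → ∃[ b ] outdeg D b ≢ Δ
  ∃-non-max-vertex D∈EX 8≤n = ¬∀⟶∃¬ n _ (λ b → outdeg D b ≟ Δ) λ regular →
    regular-unique-walks-impossible {D = D} D∈EX 8≤n regular
      (λ x → unique-walks-from-max (regular x))

  no-max-out-neighbour : InEX D → 8 ≤ n → ∀ {r} → v ⟶[ D ] r → outdeg D r ≢ Δ
  no-max-out-neighbour D∈EX 8≤n v→r dr≡Δ =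
    max-out-neighbour-impossible v→r dr≡Δ (proj₂ (∃-non-max-vertex D∈EX 8≤n))

  module _ (D∈EX : InEX D) (8≤n : 8 ≤ n) {u : Fin n} (du≡Δ : outdeg D u ≡ Δ) where

    private
      lost-neighbour-impossible : ∀ {r} → v ⟶[ D ] r → ¬ ¬ u ⟶[ D ] r
      lost-neighbour-impossible v→r u↛r =
        no-max-out-neighbour D∈EX 8≤n v→r (lost-neighbour-max du≡Δ v→r u↛r)

    N⁺v⊆N⁺max : ∀ {x} → v ⟶[ D ] x → u ⟶[ D ] x
    N⁺v⊆N⁺max v→x = decidable-stable (_ Bool.≟ true) (lost-neighbour-impossible v→x)

    N⁺max⊆N⁺v : ∀ {x} → u ⟶[ D ] x → v ⟶[ D ] x
    N⁺max⊆N⁺v u→x = decidable-stable (_ Bool.≟ true) λ v↛x →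
      let r , r∈N⁺v∖N⁺u = ∖-nonempty-sym {p = adj D u} du≡Δ (∈∖ (adj D u) (adj D v) u→x v↛x)
          v→r , u↛r     = ∈∖⁻ (adj D v) (adj D u) r∈N⁺v∖N⁺u
      in lost-neighbour-impossible v→r u↛r

lemma7 : (n : ℕ) → 8 ≤ n → (D : Digraph n) → InEX D →
    (v : Fin n) → (∀ u → outdeg D u ≤ outdeg D v) →
    (∀ x → ∃[ a ] ((v ⟶[ D ] a × a ⟶[ D ] x) ×
                   (∀ b → v ⟶[ D ] b → b ⟶[ D ] x → b ≡ a))) →
    (∀ u → ¬ (v ⟶[ D ] u) → outdeg D u ≡ outdeg D v) →
    ∀ u → ¬ (v ⟶[ D ] u) →
      ∀ x → (u ⟶[ D ] x → v ⟶[ D ] x) × (v ⟶[ D ] x → u ⟶[ D ] x)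
lemma7 n 8≤n D D∈EX v Δ-max unique-via-N⁺v Δ-off-N⁺v u v↛u x =
  N⁺max⊆N⁺v D∈EX 8≤n du≡Δ , N⁺v⊆N⁺max D∈EX 8≤n du≡Δ
  where
  unique-walks-from-v : ∀ z → walks₂ D v z ≡ 1
  unique-walks-from-v z =
    let _ , (v→a , a→z) , _ = unique-via-N⁺v z in walks₂≡1 D (proj₁ D∈EX) v→a a→z

  open MaxOutDegree {D = D} (proj₁ D∈EX) {v} Δ-max unique-walks-from-v Δ-off-N⁺v

  du≡Δ : outdeg D u ≡ Δ
  du≡Δ = Δ-off-N⁺v u v↛u
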